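{- Let $p$ be a prime and let $0\le \ell\le k$ be integers. Suppose $$n=\sum_{j=\ell}^k b_j\sigma_j,$$ where the $b_j$ are integers with $b_k\ge 1$, $0\le b_j\le p-1$ for $j\ne \ell$, and $1\le b_\ell\le p$. Then $$\lambda_p(n)\ge \sum_{j=\ell}^k b_j p^j.$$
   Context: For an integer $k\ge 0$, $\sigma_k=\sum_{j=0}^k p^j$. For $\vec v\in\mathbb{F}_p^n$, $\|\vec v\|$ denotes the number of nonzero coordinates. For a matrix $M$ over $\mathbb{F}_p$, its capacity is $c(M)=\max_{\vec v\in \mathrm{row}(M)}\|\vec v\|$, where $\mathrm{row}(M)$ is the $\mathbb{F}_p$-span of its rows. For $n\ge1$, $\mathcal{M}_n^*$ is the set of $m\times n$ matrices over $\mathbb{F}_p$ with $1\le m\le p^n$ and no zero column, and $\lambda_p(n)=\min_{M\in\mathcal{M}_n^*} c(M)$. -}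

module Defs where

open import Data.Nat using (ℕ; zero; suc; _+_; _*_; _∸_; _^_; _⊔_; _⊓_)
open import Data.Nat.Divisibility using (_∣?_)
open import Data.Fin using (Fin; toℕ)
open import Data.Bool using (Bool; true; false; _∧_; _∨_; if_then_else_)
open import Data.Vec as V using (Vec; []; _∷_)
open import Data.List as L using (List)
open import Relation.Nullary.Decidable using (does)
open import Data.Nat.ListAction using (sum)

σ : ℕ → ℕ → ℕ
σ p zero    = 1
σ p (suc k) = σ p k + p ^ suc k

-- Σ_{j=ℓ}^{k} f j  (empty sum when ℓ > k)
sumFromTo : ℕ → ℕ → (ℕ → ℕ) → ℕ
sumFromTo ℓ k f = sum (L.map (λ i → f (ℓ + i)) (L.upTo (suc k ∸ ℓ)))

allVecsOf : {A : Set} → List A → (m : ℕ) → List (Vec A m)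
allVecsOf xs zero    = [] L.∷ L.[]
allVecsOf xs (suc m) = L.concatMap (λ v → L.map (λ x → x ∷ v) xs) (allVecsOf xs m)

-- Elements of F_p are represented by Fin p (residues 0..p-1).
-- An m×n matrix over F_p is a Vec of m rows, each a Vec of n entries.
Matrix : ℕ → ℕ → ℕ → Set
Matrix p m n = Vec (Vec (Fin p) n) m

-- Linear combination Σ_i a_i · row_i, computed over ℕ (reduce mod p afterwards).
combo : {p m n : ℕ} → Matrix p m n → Vec (Fin p) m → Vec ℕ n
combo {n = n} []      []      = V.replicate n 0
combo         (r ∷ M) (c ∷ a) = V.zipWith _+_ (V.map (λ x → toℕ c * toℕ x) r) (combo M a)

-- Hamming weight in F_p^n: number of coordinates not divisible by p.
weight : {n : ℕ} → (p : ℕ) → Vec ℕ n → ℕ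
weight p v = sum (L.map (λ x → if does (p ∣? x) then 0 else 1) (V.toList v))

capacity : {p m n : ℕ} → Matrix p m n → ℕ
capacity {p} {m} M = L.foldr _⊔_ 0 (L.map (λ a → weight p (combo M a)) (allVecsOf (L.allFin p) m))

noZeroColumn : {p m n : ℕ} → Matrix p m n → Bool
noZeroColumn M = V.foldr _ _∧_ true
  (V.map (λ col → V.foldr _ _∨_ false (V.map (λ x → nonzero (toℕ x)) col)) (V.transpose M))
  where
  nonzero : ℕ → Bool
  nonzero zero    = false
  nonzero (suc _) = true

allMatrices : (p m n : ℕ) → List (Matrix p m n)
allMatrices p m n = allVecsOf (allVecsOf (L.allFin p) n) m

capacitiesStar : (p n : ℕ) → List ℕ
capacitiesStar p n = L.concatMap
  (λ i → L.map capacity (L.filterᵇ noZeroColumn (allMatrices p (suc i) n)))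
  (L.upTo (p ^ n))

-- λ_p(n) = min over M_n^* of c(M). The fold starts at n, which is harmless:
-- every capacity is ≤ n and M_n^* is nonempty for n ≥ 1, p ≥ 2.
λp : ℕ → ℕ → ℕ
λp p n = L.foldr _⊓_ n (capacitiesStar p n)

-- Let M have n nonzero columns over F_p and capacity c.  If u has maximal weight c in the row
-- space, averaging the weights of w + l u over l < p shows that the columns orthogonal to u
-- carry a row space of capacity at most ⌊c/p⌋; by induction n ≤ c + ⌊c/p⌋ + ⌊c/p²⌋ + ⋯.
-- If c < Σ b_j p^j this bound is < Σ b_j σ_j = n, by comparing c with the base-p expansion of
-- Σ b_j p^j - 1; its digits are b_ℓ - 1, b_{ℓ+1}, … exactly because b_ℓ ≤ p and b_j < p for j > ℓ.
module Submission where

open import Defs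
open import Algebra.Properties.CommutativeSemigroup using (interchange)
open import Data.Bool using (Bool; true; false; T; if_then_else_; _∧_; _∨_)
open import Data.Bool.Properties using (T?; T-∧; T-∨)
open import Data.Empty using (⊥)
open import Data.Fin as Fin using (Fin; toℕ; fromℕ<)
open import Data.Fin.Properties using (toℕ<n; toℕ-fromℕ<)
open import Data.List as L using (List)
open import Data.List.Extrema.Nat using (argmax; f[⊥]≤f[argmax]; f[xs]≤f[argmax])
open import Data.List.Membership.Propositional using (_∈_)
open import Data.List.Membership.Propositional.Properties using (∈-allFin; ∈-map⁺; ∈-concatMap⁺)
open import Data.List.Properties using (map-applyUpTo; foldr-forcesᵇ; foldr-preservesᵇ)
open import Data.List.Relation.Unary.All as All using (All)
import Data.List.Relation.Unary.All.Properties as AllP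
open import Data.List.Relation.Unary.Any as Any using (here)
open import Data.Nat
open import Data.Nat.DivMod
open import Data.Nat.Divisibility
open import Data.Nat.ListAction using (sum)
open import Data.Nat.Primality using (Prime; euclidsLemma; prime⇒nonZero; prime⇒nonTrivial)
open import Data.Nat.Properties
open import Data.Nat.Tactic.RingSolver using (solve-∀)
open import Data.Product using (∃-syntax; _,_)
open import Data.Sum using (inj₁; inj₂)
open import Data.Vec as V using (Vec; []; _∷_)
open import Data.Vec.Properties using (map-replicate; length-toList)
import Data.Vec.Relation.Unary.Any as VAny
open import Function using (_∘_)
open import Function.Bundles using (Equivalence)
open import Relation.Binary.PropositionalEquality
open import Relation.Nullary using (¬_; does; yes; no; contradiction)
open import Relation.Nullary.Decidable using (dec-false)

sumTo : ℕ → (ℕ → ℕ) → ℕ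
sumTo n f = sum (L.applyUpTo f n)

sumTo-cong : ∀ n {f g : ℕ → ℕ} → (∀ i → f i ≡ g i) → sumTo n f ≡ sumTo n g
sumTo-cong zero    f≗g = refl
sumTo-cong (suc n) f≗g = cong₂ _+_ (f≗g 0) (sumTo-cong n (f≗g ∘ suc))

sumTo-mono-≤ : ∀ n {f g : ℕ → ℕ} → (∀ i → f i ≤ g i) → sumTo n f ≤ sumTo n g
sumTo-mono-≤ zero    f≤g = z≤n
sumTo-mono-≤ (suc n) f≤g = +-mono-≤ (f≤g 0) (sumTo-mono-≤ n (f≤g ∘ suc))

sumTo-distrib-+ : ∀ n (f g : ℕ → ℕ) → sumTo n (λ i → f i + g i) ≡ sumTo n f + sumTo n g
sumTo-distrib-+ zero    f g = refl
sumTo-distrib-+ (suc n) f g = begin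
  (f 0 + g 0) + sumTo n (λ i → f (suc i) + g (suc i))
    ≡⟨ cong ((f 0 + g 0) +_) (sumTo-distrib-+ n (f ∘ suc) (g ∘ suc)) ⟩
  (f 0 + g 0) + (sumTo n (f ∘ suc) + sumTo n (g ∘ suc))
    ≡⟨ interchange +-commutativeSemigroup (f 0) (g 0) _ _ ⟩
  (f 0 + sumTo n (f ∘ suc)) + (g 0 + sumTo n (g ∘ suc)) ∎
  where open ≡-Reasoning

sumTo-distribʳ-* : ∀ n c (f : ℕ → ℕ) → sumTo n (λ i → f i * c) ≡ sumTo n f * c
sumTo-distribʳ-* zero    c f = refl
sumTo-distribʳ-* (suc n) c f =
  trans (cong (f 0 * c +_) (sumTo-distribʳ-* n c (f ∘ suc))) (sym (*-distribʳ-+ c (f 0) _))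

sumTo-const : ∀ n c → sumTo n (λ _ → c) ≡ n * c
sumTo-const zero    c = refl
sumTo-const (suc n) c = cong (c +_) (sumTo-const n c)

sumFromTo-sumTo : ∀ ℓ d f → sumFromTo ℓ (ℓ + d) f ≡ sumTo (suc d) (λ i → f (ℓ + i))
sumFromTo-sumTo ℓ d f = begin
  sum (L.map (λ i → f (ℓ + i)) (L.upTo (suc (ℓ + d) ∸ ℓ)))
    ≡⟨ cong (λ m → sum (L.map (λ i → f (ℓ + i)) (L.upTo m))) (+-∸-assoc 1 (m≤m+n ℓ d)) ⟩
  sum (L.map (λ i → f (ℓ + i)) (L.upTo (suc (ℓ + d ∸ ℓ))))
    ≡⟨ cong (λ m → sum (L.map (λ i → f (ℓ + i)) (L.upTo (suc m)))) (m+n∸m≡n ℓ d) ⟩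
  sum (L.map (λ i → f (ℓ + i)) (L.upTo (suc d)))
    ≡⟨ cong sum (map-applyUpTo (λ i → i) (λ i → f (ℓ + i)) (suc d)) ⟩
  sumTo (suc d) (λ i → f (ℓ + i)) ∎
  where open ≡-Reasoning

0<σ : ∀ p k → 0 < σ p k
0<σ p zero    = z<s
0<σ p (suc k) = ≤-trans (0<σ p k) (m≤m+n _ _)

^≤σ : ∀ p k → p ^ k ≤ σ p k
^≤σ p zero    = ≤-refl
^≤σ p (suc k) = m≤n+m _ _

module _ (p : ℕ) .{{_ : NonZero p}} where

  -- floorSum f c = Σ_{t<f} ⌊c/p^t⌋, since ⌊⌊c/p⌋/p^t⌋ = ⌊c/p^(t+1)⌋.
  floorSum : ℕ → ℕ → ℕ
  floorSum zero    c = 0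
  floorSum (suc f) c = c + floorSum f (c / p)

  floorSum-mono-≤ : ∀ f {c d} → c ≤ d → floorSum f c ≤ floorSum f d
  floorSum-mono-≤ zero    c≤d = z≤n
  floorSum-mono-≤ (suc f) c≤d = +-mono-≤ c≤d (floorSum-mono-≤ f (/-monoˡ-≤ p c≤d))

  floorSum-zero : ∀ f → floorSum f 0 ≡ 0
  floorSum-zero zero    = refl
  floorSum-zero (suc f) = trans (cong (floorSum f) (0/n≡0 p)) (floorSum-zero f)

  [a+d*p]/p≡d : ∀ {a} d → a < p → (a + d * p) / p ≡ d
  [a+d*p]/p≡d {a} d a<p = begin
    (a + d * p) / p   ≡⟨ +-distrib-/-∣ʳ a (divides-refl d) ⟩
    a / p + d * p / p ≡⟨ cong₂ _+_ (m<n⇒m/n≡0 a<p) (m*n/n≡m d p) ⟩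
    d                 ∎
    where open ≡-Reasoning

  sumTo-*-^-suc : ∀ n (g e : ℕ → ℕ) →
    sumTo n (λ i → g i * p ^ suc (e i)) ≡ sumTo n (λ i → g i * p ^ e i) * p
  sumTo-*-^-suc n g e =
    trans (sumTo-cong n (λ i → reassoc (g i) (p ^ e i))) (sumTo-distribʳ-* n p (λ i → g i * p ^ e i))
    where
    reassoc : ∀ x y → x * (p * y) ≡ x * y * p
    reassoc x y = trans (cong (x *_) (*-comm p y)) (sym (*-assoc x y p))

  sumTo-*-σ-suc : ∀ n (g e : ℕ → ℕ) →
    sumTo n (λ i → g i * σ p (suc (e i))) ≡
    sumTo n (λ i → g i * σ p (e i)) + sumTo n (λ i → g i * p ^ suc (e i))
  sumTo-*-σ-suc n g e = trans (sumTo-cong n (λ i → *-distribˡ-+ (g i) _ _)) (sumTo-distrib-+ n _ _)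

  floorSum-digits : ∀ f d (a : ℕ → ℕ) → (∀ i → i < d → a i < p) →
    floorSum f (sumTo d (λ i → a i * p ^ i)) ≤ sumTo d (λ i → a i * σ p i)
  floorSum-digits zero    d       a a<p = z≤n
  floorSum-digits (suc f) zero    a a<p = ≤-reflexive (floorSum-zero (suc f))
  floorSum-digits (suc f) (suc d) a a<p = begin
    (a₀ + R) + floorSum f ((a₀ + R) / p) ≡⟨ cong (λ x → (a₀ + R) + floorSum f x) drop-digit ⟩
    (a₀ + R) + floorSum f D              ≤⟨ +-monoʳ-≤ (a₀ + R) (floorSum-digits f d (a ∘ suc) a′<p) ⟩
    (a₀ + R) + E                         ≡⟨ +-assoc a₀ R E ⟩
    a₀ + (R + E)                         ≡⟨ cong (a₀ +_) (+-comm R E) ⟩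
    a₀ + (E + R)                         ≡⟨ cong (a₀ +_) (sumTo-*-σ-suc d (a ∘ suc) (λ i → i)) ⟨
    a₀ + sumTo d (λ i → a (suc i) * σ p (suc i)) ∎
    where
    open ≤-Reasoning
    a₀ = a 0 * 1
    R = sumTo d (λ i → a (suc i) * p ^ suc i)
    D = sumTo d (λ i → a (suc i) * p ^ i)
    E = sumTo d (λ i → a (suc i) * σ p i)
    a′<p : ∀ i → i < d → a (suc i) < p
    a′<p i = a<p (suc i) ∘ s≤s
    drop-digit : (a₀ + R) / p ≡ D
    drop-digit = begin-equality
      (a₀ + R) / p     ≡⟨ cong (λ r → (a₀ + r) / p) (sumTo-*-^-suc d (a ∘ suc) (λ i → i)) ⟩
      (a₀ + D * p) / p ≡⟨ [a+d*p]/p≡d D (subst (_< p) (sym (*-identityʳ (a 0))) (a<p 0 z<s)) ⟩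
      D                ∎

  -- For ℓ = 0 compare c with N - 1, whose base-p digits are b₀ - 1 < p, b₁, …, b_d.  For ℓ > 0,
  -- c < N and c / p < N / p bound the two parts of floorSum, as σ_{j+1} = σ_j + p^{j+1}.
  floorSum-<-σ : ∀ ℓ d (b : ℕ → ℕ) → 1 ≤ b 0 → b 0 ≤ p → (∀ i → i < d → b (suc i) < p) →
    ∀ f {c} → c < sumTo (suc d) (λ i → b i * p ^ (ℓ + i)) →
    floorSum f c < sumTo (suc d) (λ i → b i * σ p (ℓ + i))
  floorSum-<-σ zero d b b₀≥1 b₀≤p b<p f {c} c<N =
    subst (floorSum f c <_) (suc-pred-*1+ b₀≥1) (s≤s (begin
      floorSum f c                                   ≤⟨ floorSum-mono-≤ f c≤N-1 ⟩
      floorSum f (sumTo (suc d) (λ i → a i * p ^ i)) ≤⟨ floorSum-digits f (suc d) a a<p ⟩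
      sumTo (suc d) (λ i → a i * σ p i)              ∎))
    where
    open ≤-Reasoning
    a : ℕ → ℕ
    a zero    = pred (b 0)
    a (suc i) = b (suc i)
    suc-pred-*1+ : ∀ {m} {x} → 1 ≤ m → suc (pred m * 1 + x) ≡ m * 1 + x
    suc-pred-*1+ {suc m} _ = refl
    pred<-≤ : ∀ {m} → 1 ≤ m → m ≤ p → pred m < p
    pred<-≤ {suc m} _ m<p = m<p
    a<p : ∀ i → i < suc d → a i < p
    a<p zero    _   = pred<-≤ b₀≥1 b₀≤p
    a<p (suc i) i<d = b<p i (≤-pred i<d)
    c≤N-1 : c ≤ sumTo (suc d) (λ i → a i * p ^ i)
    c≤N-1 = ≤-pred (subst (c <_) (sym (suc-pred-*1+ b₀≥1)) c<N)
  floorSum-<-σ (suc ℓ) d b b₀≥1 b₀≤p b<p zero c<N =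
    ≤-trans (*-mono-≤ b₀≥1 (0<σ p (suc ℓ + 0))) (m≤m+n _ _)
  floorSum-<-σ (suc ℓ) d b b₀≥1 b₀≤p b<p (suc f) {c} c<N =
    subst (c + floorSum f (c / p) <_) (trans (+-comm N n′) (sym (sumTo-*-σ-suc (suc d) b (ℓ +_))))
      (+-mono-< c<N c/p-bound)
    where
    N = sumTo (suc d) (λ i → b i * p ^ (suc ℓ + i))
    n′ = sumTo (suc d) (λ i → b i * σ p (ℓ + i))
    c/p-bound : floorSum f (c / p) < n′
    c/p-bound = floorSum-<-σ ℓ d b b₀≥1 b₀≤p b<p f
      (m<n*o⇒m/o<n (subst (c <_) (sumTo-*-^-suc (suc d) b (ℓ +_)) c<N))

%-cong-+ : ∀ {a a′ b b′ d} .{{_ : NonZero d}} →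
  a % d ≡ a′ % d → b % d ≡ b′ % d → (a + b) % d ≡ (a′ + b′) % d
%-cong-+ {a} {a′} {b} {b′} {d} a≡a′ b≡b′ = begin
  (a + b) % d             ≡⟨ %-distribˡ-+ a b d ⟩
  (a % d + b % d) % d     ≡⟨ cong₂ (λ x y → (x + y) % d) a≡a′ b≡b′ ⟩
  (a′ % d + b′ % d) % d   ≡⟨ %-distribˡ-+ a′ b′ d ⟨
  (a′ + b′) % d           ∎
  where open ≡-Reasoning

%-cong-*ʳ : ∀ {a a′} b {d} .{{_ : NonZero d}} → a % d ≡ a′ % d → (a * b) % d ≡ (a′ * b) % d
%-cong-*ʳ {a} {a′} b {d} a≡a′ = begin
  (a * b) % d             ≡⟨ %-distribˡ-* a b d ⟩
  (a % d * (b % d)) % d   ≡⟨ cong (λ x → (x * (b % d)) % d) a≡a′ ⟩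
  (a′ % d * (b % d)) % d  ≡⟨ %-distribˡ-* a′ b d ⟨
  (a′ * b) % d            ∎
  where open ≡-Reasoning

∈-allVecsOf : ∀ {A : Set} {xs : List A} → (∀ x → x ∈ xs) → ∀ {m} (v : Vec A m) → v ∈ allVecsOf xs m
∈-allVecsOf all∈xs []      = here refl
∈-allVecsOf all∈xs (x ∷ v) =
  ∈-concatMap⁺ _ (Any.map (λ { refl → ∈-map⁺ (_∷ v) (all∈xs x) }) (∈-allVecsOf all∈xs v))

T-foldr-∧ : ∀ {A : Set} {n} (g : A → Bool) (xs : Vec A n) →
  T (V.foldr _ _∧_ true (V.map g xs)) → All (T ∘ g) (V.toList xs)
T-foldr-∧ g []       _ = All.[]
T-foldr-∧ g (x ∷ xs) t = let gx , rest = Equivalence.to T-∧ t in gx All.∷ T-foldr-∧ g xs rest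

T-foldr-∨ : ∀ {A : Set} {n} (g : A → Bool) (xs : Vec A n) →
  T (V.foldr _ _∨_ false (V.map g xs)) → VAny.Any (T ∘ g) xs
T-foldr-∨ g []       ()
T-foldr-∨ g (x ∷ xs) t with Equivalence.to T-∨ t
... | inj₁ gx   = VAny.here gx
... | inj₂ rest = VAny.there (T-foldr-∨ g xs rest)

≤-foldr-⊔ : ∀ {A : Set} (g : A → ℕ) xs {x} → x ∈ xs → g x ≤ L.foldr _⊔_ 0 (L.map g xs)
≤-foldr-⊔ g xs = All.lookup (AllP.map⁻ (foldr-forcesᵇ {P = _≤ L.foldr _⊔_ 0 (L.map g xs)} {f = _⊔_}
  (λ x y x⊔y≤ → m⊔n≤o⇒m≤o x y x⊔y≤ , m⊔n≤o⇒n≤o x y x⊔y≤) 0 (L.map g xs) ≤-refl))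

module _ (p : ℕ) (p-prime : Prime p) where

  private instance
    p≢0 : NonZero p
    p≢0 = prime⇒nonZero p-prime

  [p∤_] : ℕ → ℕ
  [p∤ x ] = if does (p ∣? x) then 0 else 1

  [p∤]-∤ : ∀ {x} → ¬ p ∣ x → [p∤ x ] ≡ 1
  [p∤]-∤ {x} p∤x = cong (λ b → if b then 0 else 1) (dec-false (p ∣? x) p∤x)

  ∣-resp-% : ∀ {x y} → x % p ≡ y % p → p ∣ x → p ∣ y
  ∣-resp-% {x} {y} x≡y p∣x = m%n≡0⇒n∣m y p (trans (sym x≡y) (n∣m⇒m%n≡0 x p p∣x))

  [p∤]-cong-% : ∀ {x y} → x % p ≡ y % p → [p∤ x ] ≡ [p∤ y ]
  [p∤]-cong-% {x} {y} x≡y with p ∣? x | p ∣? y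
  ... | yes _   | yes _   = refl
  ... | no _    | no _    = refl
  ... | yes p∣x | no p∤y  = contradiction (∣-resp-% x≡y p∣x) p∤y
  ... | no p∤x  | yes p∣y = contradiction (∣-resp-% (sym x≡y) p∣y) p∤x

  sumTo-[p∤]-no-root : ∀ n (g : ℕ → ℕ) → (∀ i → i < n → ¬ p ∣ g i) → sumTo n (λ i → [p∤ g i ]) ≡ n
  sumTo-[p∤]-no-root zero    g _     = refl
  sumTo-[p∤]-no-root (suc n) g p∤g =
    cong₂ _+_ ([p∤]-∤ (p∤g 0 z<s)) (sumTo-[p∤]-no-root n (g ∘ suc) (λ i → p∤g (suc i) ∘ s<s))

  sumTo-[p∤]-one-root : ∀ n (g : ℕ → ℕ) → (∀ {i j} → i < j → j < n → p ∣ g i → p ∣ g j → ⊥) →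
    n ≤ suc (sumTo n (λ i → [p∤ g i ]))
  sumTo-[p∤]-one-root zero    g _      = z≤n
  sumTo-[p∤]-one-root (suc n) g unique with p ∣? g 0
  ... | yes p∣g₀ = s≤s (≤-reflexive (sym
          (sumTo-[p∤]-no-root n (g ∘ suc) (λ i i<n → unique z<s (s<s i<n) p∣g₀))))
  ... | no _     = s≤s (sumTo-[p∤]-one-root n (g ∘ suc) (λ i<j j<n → unique (s<s i<j) (s<s j<n)))

  affine-root-unique : ∀ {A B i j} → ¬ p ∣ B → i < j → j < p → p ∣ A + i * B → p ∣ A + j * B → ⊥
  affine-root-unique {A} {B} {i} {j} p∤B i<j j<p p∣Ai p∣Aj
    with euclidsLemma (j ∸ i) B p-prime (∣m+n∣m⇒∣n (subst (p ∣_) split p∣Aj) p∣Ai)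
    where
    split : A + j * B ≡ (A + i * B) + (j ∸ i) * B
    split = begin
      A + j * B                 ≡⟨ cong (λ x → A + x * B) (m+[n∸m]≡n (<⇒≤ i<j)) ⟨
      A + (i + (j ∸ i)) * B     ≡⟨ cong (A +_) (*-distribʳ-+ B i (j ∸ i)) ⟩
      A + (i * B + (j ∸ i) * B) ≡⟨ +-assoc A _ _ ⟨
      (A + i * B) + (j ∸ i) * B ∎
      where open ≡-Reasoning
  ... | inj₂ p∣B   = p∤B p∣B
  ... | inj₁ p∣j∸i = <⇒≱ j<p (≤-trans (∣⇒≤ ⦃ >-nonZero (m<n⇒0<n∸m i<j) ⦄ p∣j∸i) (m∸n≤m j i))

  infixl 7 _·_
  _·_ : ∀ {m} → Vec (Fin p) m → Vec (Fin p) m → ℕ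
  []       · []       = 0
  (a ∷ as) · (x ∷ xs) = toℕ a * toℕ x + as · xs

  addMultiple : ∀ {m} → ℕ → Vec (Fin p) m → Vec (Fin p) m → Vec (Fin p) m
  addMultiple l []       []       = []
  addMultiple l (u ∷ us) (w ∷ ws) = (toℕ w + l * toℕ u) mod p ∷ addMultiple l us ws

  ·-addMultiple : ∀ {m} l (u w x : Vec (Fin p) m) → addMultiple l u w · x % p ≡ (w · x + l * (u · x)) % p
  ·-addMultiple l []       []       []       = cong (_% p) (sym (*-zeroʳ l))
  ·-addMultiple l (u ∷ us) (w ∷ ws) (x ∷ xs) = begin
    (toℕ ((toℕ w + l * toℕ u) mod p) * toℕ x + addMultiple l us ws · xs) % p
      ≡⟨ %-cong-+ {d = p} (%-cong-*ʳ (toℕ x) {d = p} reduce) (·-addMultiple l us ws xs) ⟩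
    ((toℕ w + l * toℕ u) * toℕ x + (ws · xs + l * (us · xs))) % p
      ≡⟨ cong (_% p) (regroup (toℕ w) (toℕ u) (toℕ x) (ws · xs) (us · xs) l) ⟩
    (toℕ w * toℕ x + ws · xs + l * (toℕ u * toℕ x + us · xs)) % p ∎
    where
    open ≡-Reasoning
    regroup : ∀ w u x W U l → (w + l * u) * x + (W + l * U) ≡ (w * x + W) + l * (u * x + U)
    regroup = solve-∀
    reduce : toℕ ((toℕ w + l * toℕ u) mod p) % p ≡ (toℕ w + l * toℕ u) % p
    reduce = trans (cong (_% p) (toℕ-fromℕ< (m%n<n _ p))) (m%n%n≡m%n _ p)

  wt : ∀ {m} → Vec (Fin p) m → List (Vec (Fin p) m) → ℕ
  wt a cs = sum (L.map (λ x → [p∤ a · x ]) cs)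

  ker : ∀ {m} → Vec (Fin p) m → List (Vec (Fin p) m) → List (Vec (Fin p) m)
  ker u = L.filter (λ x → p ∣? u · x)

  length-ker : ∀ {m} (u : Vec (Fin p) m) cs → L.length cs ≡ wt u cs + L.length (ker u cs)
  length-ker u L.[]       = refl
  length-ker u (x L.∷ xs) with p ∣? u · x
  ... | yes _ = trans (cong suc (length-ker u xs)) (sym (+-suc _ _))
  ... | no _  = cong suc (length-ker u xs)

  module _ {m} (u w x : Vec (Fin p) m) where

    columnSum : ℕ
    columnSum = sumTo p (λ l → [p∤ addMultiple l u w · x ])

    columnSum-∣ : p ∣ u · x → columnSum ≡ p * [p∤ w · x ]
    columnSum-∣ p∣ux = trans
      (sumTo-cong p (λ l → [p∤]-cong-% (trans (·-addMultiple l u w x)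
                                              (%-remove-+ʳ (w · x) (∣n⇒∣m*n l p∣ux)))))
      (sumTo-const p [p∤ w · x ])

    -- l ↦ w·x + l (u·x) is injective mod p, so it vanishes for at most one l < p.
    columnSum-∤ : ¬ p ∣ u · x → p ≤ suc columnSum
    columnSum-∤ p∤ux = subst (λ s → p ≤ suc s)
      (sym (sumTo-cong p (λ l → [p∤]-cong-% (·-addMultiple l u w x))))
      (sumTo-[p∤]-one-root p (λ l → w · x + l * (u · x)) (λ i<j j<p → affine-root-unique p∤ux i<j j<p))

  average-∷ : ∀ {m} (w u x : Vec (Fin p) m) xs {k b} →
    p * k + p * b ≤ columnSum u w x + b →
    p * wt w (ker u xs) + p * wt u xs ≤ sumTo p (λ l → wt (addMultiple l u w) xs) + wt u xs →
    p * (k + wt w (ker u xs)) + p * (b + wt u xs) ≤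
    sumTo p (λ l → wt (addMultiple l u w) (x L.∷ xs)) + (b + wt u xs)
  average-∷ w u x xs {k} {b} column rest = begin
    p * (k + K) + p * (b + U)         ≡⟨ cong₂ _+_ (*-distribˡ-+ p k K) (*-distribˡ-+ p b U) ⟩
    (p * k + p * K) + (p * b + p * U) ≡⟨ interchange +-commutativeSemigroup (p * k) (p * K) _ _ ⟩
    (p * k + p * b) + (p * K + p * U) ≤⟨ +-mono-≤ column rest ⟩
    (s + b) + (S + U)                 ≡⟨ interchange +-commutativeSemigroup s b S U ⟩
    (s + S) + (b + U)                 ≡⟨ cong (_+ (b + U)) (sumTo-distrib-+ p _ _) ⟨
    sumTo p (λ l → wt (addMultiple l u w) (x L.∷ xs)) + (b + U) ∎
    where
    open ≤-Reasoning
    K = wt w (ker u xs)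
    U = wt u xs
    s = columnSum u w x
    S = sumTo p (λ l → wt (addMultiple l u w) xs)

  average : ∀ {m} (w u : Vec (Fin p) m) cs →
    p * wt w (ker u cs) + p * wt u cs ≤ sumTo p (λ l → wt (addMultiple l u w) cs) + wt u cs
  average w u L.[] = ≤-trans (≤-reflexive (cong₂ _+_ (*-zeroʳ p) (*-zeroʳ p))) z≤n
  average w u (x L.∷ xs) with p ∣? u · x
  ... | yes p∣ux = average-∷ w u x xs (≤-reflexive column) (average w u xs)
    where
    column : p * [p∤ w · x ] + p * 0 ≡ columnSum u w x + 0
    column = trans (cong (p * [p∤ w · x ] +_) (*-zeroʳ p)) (sym (cong (_+ 0) (columnSum-∣ u w x p∣ux)))
  ... | no p∤ux = average-∷ w u x xs column (average w u xs)
    where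
    column : p * 0 + p * 1 ≤ columnSum u w x + 1
    column = subst₂ _≤_ (sym (cong₂ _+_ (*-zeroʳ p) (*-identityʳ p))) (+-comm 1 _) (columnSum-∤ u w x p∤ux)

  -- Averaging w + l u over l < p: every such vector has weight at most that of u on cs.
  wt-ker-≤ : ∀ {m} (w u : Vec (Fin p) m) cs → (∀ a → wt a cs ≤ wt u cs) → wt w (ker u cs) ≤ wt u cs / p
  wt-ker-≤ w u cs u-max = begin
    K         ≡⟨ m*n/n≡m K p ⟨
    K * p / p ≤⟨ /-monoˡ-≤ p (subst (_≤ c) (*-comm p K) p*K≤c) ⟩
    c / p     ∎
    where
    open ≤-Reasoning
    K = wt w (ker u cs)
    c = wt u cs
    p*K≤c : p * K ≤ c
    p*K≤c = +-cancelʳ-≤ (p * c) (p * K) c (begin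
      p * K + p * c                                  ≤⟨ average w u cs ⟩
      sumTo p (λ l → wt (addMultiple l u w) cs) + c
        ≤⟨ +-monoˡ-≤ c (sumTo-mono-≤ p (λ l → u-max (addMultiple l u w))) ⟩
      sumTo p (λ _ → c) + c                          ≡⟨ cong (_+ c) (sumTo-const p c) ⟩
      p * c + c                                      ≡⟨ +-comm (p * c) c ⟩
      c + p * c                                      ∎)

  allVecs : ∀ m → List (Vec (Fin p) m)
  allVecs = allVecsOf (L.allFin p)

  ∈-allVecs : ∀ {m} (v : Vec (Fin p) m) → v ∈ allVecs m
  ∈-allVecs = ∈-allVecsOf ∈-allFin

  -- x ≠ 0 in F_p^m, witnessed by a functional that does not vanish at x.
  Nonvanishing : ∀ {m} → Vec (Fin p) m → Set
  Nonvanishing x = ∃[ a ] ¬ p ∣ a · x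

  -- Take u of maximal weight c′ ≥ 1 on cs: the columns off ker u contribute c′, and the
  -- columns in ker u again form such a family, of maximal weight ≤ c′ / p.
  length-≤-floorSum : ∀ {m} f c (cs : List (Vec (Fin p) m)) → L.length cs ≤ f → All Nonvanishing cs →
    (∀ a → wt a cs ≤ c) → L.length cs ≤ floorSum p f c
  length-≤-floorSum f       c L.[]             _     _                       _    = z≤n
  length-≤-floorSum (suc f) c cs@(x L.∷ xs) |cs|≤ nonvanishing@((a , p∤ax) All.∷ _) wt≤c = begin
    L.length cs                ≡⟨ length-ker u cs ⟩
    c′ + L.length (ker u cs)   ≤⟨ +-monoʳ-≤ c′ (length-≤-floorSum f (c′ / p) (ker u cs) |ker|≤f
                                   (AllP.filter⁺ (λ y → p ∣? u · y) nonvanishing)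
                                   (λ w → wt-ker-≤ w u cs u-max)) ⟩
    c′ + floorSum p f (c′ / p) ≤⟨ floorSum-mono-≤ p (suc f) (wt≤c u) ⟩
    floorSum p (suc f) c       ∎
    where
    open ≤-Reasoning
    u = argmax (λ v → wt v cs) a (allVecs _)
    c′ = wt u cs
    u-max : ∀ v → wt v cs ≤ c′
    u-max v = All.lookup (f[xs]≤f[argmax] {f = λ v → wt v cs} a (allVecs _)) (∈-allVecs v)
    c′≥1 : 1 ≤ c′
    c′≥1 = ≤-trans (subst (_≤ wt a cs) ([p∤]-∤ p∤ax) (m≤m+n _ _))
                   (f[⊥]≤f[argmax] {f = λ v → wt v cs} a (allVecs _))
    |ker|≤f : L.length (ker u cs) ≤ f
    |ker|≤f = ≤-pred (≤-trans (+-monoˡ-≤ _ c′≥1) (subst (_≤ suc f) (length-ker u cs) |cs|≤))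

  private
    0<p : 0 < p
    0<p = >-nonZero⁻¹ p
    1<p : 1 < p
    1<p = nonTrivial⇒n>1 p ⦃ prime⇒nonTrivial p-prime ⦄
    0F 1F : Fin p
    0F = fromℕ< 0<p
    1F = fromℕ< 1<p

  0F·x≡0 : ∀ {m} (x : Vec (Fin p) m) → V.replicate m 0F · x ≡ 0
  0F·x≡0 []      = refl
  0F·x≡0 (e ∷ x) = cong₂ (λ z r → z * toℕ e + r) (toℕ-fromℕ< 0<p) (0F·x≡0 x)

  nonvanishing : ∀ {m} {x : Vec (Fin p) m} → VAny.Any (λ e → 0 < toℕ e) x → Nonvanishing x
  nonvanishing {x = e ∷ x} (VAny.here 0<e) = 1F ∷ V.replicate _ 0F , p∤
    where
    p∤ : ¬ p ∣ toℕ 1F * toℕ e + V.replicate _ 0F · x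
    p∤ p∣ rewrite toℕ-fromℕ< 1<p | 0F·x≡0 x | +-identityʳ (toℕ e) | +-identityʳ (toℕ e)
      = <⇒≱ (toℕ<n e) (∣⇒≤ ⦃ >-nonZero 0<e ⦄ p∣)
  nonvanishing {x = e ∷ x} (VAny.there any) with a , p∤ax ← nonvanishing any =
    0F ∷ a , subst (λ z → ¬ p ∣ z * toℕ e + a · x) (sym (toℕ-fromℕ< 0<p)) p∤ax

  columns : ∀ {m n} → Matrix p m n → List (Vec (Fin p) m)
  columns M = V.toList (V.transpose M)

  combo≡map-· : ∀ {m n} (M : Matrix p m n) a → combo M a ≡ V.map (a ·_) (V.transpose M)
  combo≡map-· {n = n} [] [] = sym (map-replicate ([] ·_) [] n)
  combo≡map-· (r ∷ M) (c ∷ a) =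
    trans (cong (V.zipWith _+_ (V.map (λ x → toℕ c * toℕ x) r)) (combo≡map-· M a)) (add-row r (V.transpose M))
    where
    add-row : ∀ {n} (r : Vec (Fin p) n) (t : Vec (Vec (Fin p) _) n) →
      V.zipWith _+_ (V.map (λ x → toℕ c * toℕ x) r) (V.map (a ·_) t) ≡
      V.map ((c ∷ a) ·_) ((V.replicate n _∷_ V.⊛ r) V.⊛ t)
    add-row []      []      = refl
    add-row (e ∷ r) (x ∷ t) = cong (_ ∷_) (add-row r t)

  weight-map-· : ∀ {m n} a (t : Vec (Vec (Fin p) m) n) → weight p (V.map (a ·_) t) ≡ wt a (V.toList t)
  weight-map-· a []      = refl
  weight-map-· a (x ∷ t) = cong ([p∤ a · x ] +_) (weight-map-· a t)

  wt-columns≤capacity : ∀ {m n} (M : Matrix p m n) a → wt a (columns M) ≤ capacity M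
  wt-columns≤capacity {m} M a =
    subst (_≤ capacity M) (trans (cong (weight p) (combo≡map-· M a)) (weight-map-· a (V.transpose M)))
      (≤-foldr-⊔ (λ v → weight p (combo M v)) (allVecs m) (∈-allVecs a))

  columns-nonvanishing : ∀ {m n} (M : Matrix p m n) → T (noZeroColumn M) → All Nonvanishing (columns M)
  columns-nonvanishing M noZero = All.map (nonvanishing ∘ VAny.map (λ {e} → positive e) ∘ T-foldr-∨ _ _)
    (T-foldr-∧ _ (V.transpose M) noZero)
    where
    positive : ∀ e → T _ → 0 < toℕ e
    positive Fin.zero    ()
    positive (Fin.suc e) _ = z<s

  length≤floorSum-capacity : ∀ {m n} (M : Matrix p m n) → T (noZeroColumn M) → n ≤ floorSum p n (capacity M)
  length≤floorSum-capacity {n = n} M noZero = subst (_≤ floorSum p n (capacity M)) (length-toList (V.transpose M))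
    (length-≤-floorSum n (capacity M) (columns M) (≤-reflexive (length-toList (V.transpose M)))
      (columns-nonvanishing M noZero) (wt-columns≤capacity M))

λp-≥ : ∀ p n {N} → N ≤ n →
  (∀ {m} (M : Matrix p m n) → T (noZeroColumn M) → N ≤ capacity M) → N ≤ λp p n
λp-≥ p n {N} N≤n N≤capacity =
  foldr-preservesᵇ {P = N ≤_} {f = _⊓_} ⊓-glb N≤n
    (AllP.concat⁺ (AllP.map⁺ (All.universal N≤capacities (L.upTo (p ^ n)))))
  where
  N≤capacities : ∀ m → All (N ≤_) (L.map capacity (L.filterᵇ noZeroColumn (allMatrices p (suc m) n)))
  N≤capacities m =
    AllP.map⁺ (All.map (λ {M} → N≤capacity M) (AllP.all-filter (T? ∘ noZeroColumn) (allMatrices p (suc m) n)))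

capacity-≥ : ∀ {p} → Prime p → ∀ ℓ d (b : ℕ → ℕ) →
  1 ≤ b 0 → b 0 ≤ p → (∀ i → i < d → b (suc i) < p) →
  ∀ {m} (M : Matrix p m (sumTo (suc d) (λ i → b i * σ p (ℓ + i)))) → T (noZeroColumn M) →
  sumTo (suc d) (λ i → b i * p ^ (ℓ + i)) ≤ capacity M
capacity-≥ {p} p-prime ℓ d b b₀≥1 b₀≤p b<p M noZero = ≮⇒≥ λ capacity<N →
  <⇒≱ (floorSum-<-σ p ℓ d b b₀≥1 b₀≤p b<p n capacity<N) (length≤floorSum-capacity p p-prime M noZero)
  where
  instance _ = prime⇒nonZero p-prime
  n = sumTo (suc d) (λ i → b i * σ p (ℓ + i))

proposition2p3 : (p : ℕ) → Prime p → (ℓ k : ℕ) → ℓ ≤ k → (b : ℕ → ℕ) →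
    1 ≤ b k →
    (∀ j → ℓ < j → j ≤ k → b j ≤ p ∸ 1) →
    1 ≤ b ℓ → b ℓ ≤ p →
    (n : ℕ) → n ≡ sumFromTo ℓ k (λ j → b j * σ p j) →
    λp p n ≥ sumFromTo ℓ k (λ j → b j * p ^ j)
proposition2p3 p p-prime ℓ k ℓ≤k b _ b≤p∸1 bℓ≥1 bℓ≤p n n≡
  with d , refl ← m≤n⇒∃[o]m+o≡n ℓ≤k
  rewrite n≡ | sumFromTo-sumTo ℓ d (λ j → b j * σ p j) | sumFromTo-sumTo ℓ d (λ j → b j * p ^ j) =
  λp-≥ p _ (sumTo-mono-≤ (suc d) (λ i → *-monoʳ-≤ (b (ℓ + i)) (^≤σ p (ℓ + i))))
    (capacity-≥ p-prime ℓ d (λ i → b (ℓ + i))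
      (subst (λ j → 1 ≤ b j) ℓ≡ℓ+0 bℓ≥1) (subst (λ j → b j ≤ p) ℓ≡ℓ+0 bℓ≤p) digit<p)
  where
  ℓ≡ℓ+0 : ℓ ≡ ℓ + 0
  ℓ≡ℓ+0 = sym (+-identityʳ ℓ)
  digit<p : ∀ i → i < d → b (ℓ + suc i) < p
  digit<p i i<d = m≤pred[n]⇒suc[m]≤n ⦃ prime⇒nonZero p-prime ⦄ (subst (b (ℓ + suc i) ≤_)
    (sym (pred[m∸n]≡m∸[1+n] p 0)) (b≤p∸1 (ℓ + suc i) (m<m+n ℓ z<s) (+-monoʳ-≤ ℓ i<d)))
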